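{- Let $m\ge1$, let $k_1,\ldots,k_m\ge 2$ be integers with $k_1+\cdots+k_m=n$, and let $G=D_n(k_1,\ldots,k_m)$. Then $G$ is vertex decomposable and $\mathrm{Shed}(G)$ is not a dominating set of $G$.
   Context: $D_n(k_1,\ldots,k_m)$ is the graph on the $5n$ vertices $X\cup Y\cup Z$ with $X=\{x_1,\ldots,x_{2n}\}$, $Y=\{y_1,\ldots,y_{2n}\}$, $Z=\{z_1,\ldots,z_n\}$, whose edges are exactly: (i) all pairs in $Z$ (so $Z$ induces $K_n$); (ii) no edges within $Y$; (iii) the induced graph on $X$ is a disjoint union $K_{k_1,k_1}\sqcup\cdots\sqcup K_{k_m,k_m}$ where, with $w=\sum_{\ell=1}^{i-1}k_\ell$ ($w=0$ for $i=1$), the $i$-th complete bipartite graph has bipartition $\{x_{2w+1},x_{2w+3},\ldots,x_{2(w+k_i)-1}\}\cup\{x_{2w+2},x_{2w+4},\ldots,x_{2(w+k_i)}\}$; (iv) $\{x_j,y_j\}$ for $1\le j\le 2n$; (v) $\{z_j,y_{2j}\}$ and $\{z_j,y_{2j-1}\}$ for $1\le j\le n$. For a graph $G=(V,E)$ and $x\in V$, $G\setminus x$ is the graph obtained by deleting $x$ and its incident edges; $N[x]$ is $x$ together with its neighbours, and $G\setminus N[x]$ is obtained by deleting all vertices of $N[x]$ and their incident edges. A graph is well-covered if all its maximal independent sets have the same cardinality. A graph $G$ is vertex decomposable if $G$ is well-covered and either (i) $G$ has no edges (possibly no vertices), or (ii) there is a vertex $x$ such that both $G\setminus x$ and $G\setminus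 N[x]$ are vertex decomposable. For a vertex decomposable graph $G$, $\mathrm{Shed}(G)$ is the set of vertices $x$ such that $G\setminus x$ and $G\setminus N[x]$ are both vertex decomposable. A set $D\subseteq V$ is dominating if every vertex of $V\setminus D$ is adjacent to a vertex of $D$. -}

module Defs where

open import Data.Nat using (ℕ; zero; suc; _+_; _*_; _≤ᵇ_; _<ᵇ_; _≡ᵇ_; _%_)
open import Data.Bool using (Bool; true; false; _∧_; _∨_; not; T)
open import Data.Fin using (Fin; toℕ; splitAt) renaming (_≟_ to _≟ᶠ_)
open import Data.Fin.Subset using (Subset; _∈_; _∉_; _⊆_; ∣_∣; _─_; _-_; ⊤)
open import Data.Vec using (tabulate)
open import Data.List using (List; []; _∷_)
open import Data.Sum using (_⊎_; inj₁; inj₂)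
open import Data.Product using (Σ; _×_; _,_)
open import Data.Empty using (⊥)
open import Relation.Nullary using (¬_)
open import Relation.Nullary.Decidable using (⌊_⌋)
open import Relation.Binary.PropositionalEquality using (_≡_)

-- A "graph" in the recursive definitions below is an induced subgraph
-- G[S] for S : Subset N; deleting vertices shrinks S.

module GraphTheory {N : ℕ} (adj : Fin N → Fin N → Bool) where

  Adj : Fin N → Fin N → Set
  Adj u v = T (adj u v)

  Independent : Subset N → Subset N → Set
  Independent S I = I ⊆ S × (∀ u v → u ∈ I → v ∈ I → ¬ Adj u v)

  MaximalIndependent : Subset N → Subset N → Set
  MaximalIndependent S I =
    Independent S I × (∀ J → Independent S J → I ⊆ J → J ⊆ I)

  WellCovered : Subset N → Set
  WellCovered S = ∀ I J → MaximalIndependent S I → MaximalIndependent S J → ∣ I ∣ ≡ ∣ J ∣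

  NoEdges : Subset N → Set
  NoEdges S = ∀ u v → u ∈ S → v ∈ S → ¬ Adj u v

  -- closed neighbourhood N[x] (in G; intersected with S when removed)
  closedNbhd : Fin N → Subset N
  closedNbhd x = tabulate (λ v → ⌊ v ≟ᶠ x ⌋ ∨ adj x v)

  delete : Subset N → Fin N → Subset N
  delete S x = S - x

  deleteNbhd : Subset N → Fin N → Subset N
  deleteNbhd S x = S ─ closedNbhd x

  data VertexDecomposable (S : Subset N) : Set where
    vd-empty : WellCovered S → NoEdges S → VertexDecomposable S
    vd-shed  : WellCovered S → (x : Fin N) → x ∈ S →
               VertexDecomposable (delete S x) →
               VertexDecomposable (deleteNbhd S x) →
               VertexDecomposable S

  Shed : Subset N → Fin N → Set
  Shed S x = x ∈ S × VertexDecomposable (delete S x) × VertexDecomposable (deleteNbhd S x)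

  Dominating : Subset N → (Fin N → Set) → Set
  Dominating S D = ∀ v → v ∈ S → ¬ D v → Σ (Fin N) λ u → D u × u ∈ S × Adj v u

-- The graph D_n(k_1,...,k_m).  Indices are 0-based:
-- x_a (a < 2n), y_b (b < 2n), z_c (c < n) stand for x_{a+1}, y_{b+1}, z_{c+1}.

data VType (n : ℕ) : Set where
  X : Fin (2 * n) → VType n
  Y : Fin (2 * n) → VType n
  Z : Fin n → VType n

-- vertex set Fin (2n + (2n + n)) = X ∪ Y ∪ Z (5n vertices)
decode : (n : ℕ) → Fin (2 * n + (2 * n + n)) → VType n
decode n v with splitAt (2 * n) v
... | inj₁ a = X a
... | inj₂ r with splitAt (2 * n) r
...   | inj₁ b = Y b
...   | inj₂ c = Z c

-- 0-based x-index a lies in the block occupying x_{2w+1},...,x_{2(w+k)}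
inBlock : ℕ → ℕ → ℕ → Bool
inBlock w k a = (2 * w ≤ᵇ a) ∧ (a <ᵇ 2 * (w + k))

-- a and b lie in a common block; w = k_1 + ... + k_{i-1}
sameBlock : ℕ → List ℕ → ℕ → ℕ → Bool
sameBlock w [] a b = false
sameBlock w (k ∷ ks) a b = (inBlock w k a ∧ inBlock w k b) ∨ sameBlock (w + k) ks a b

-- edges inside X: same block, opposite sides (odd vs even index)
xadj : List ℕ → ℕ → ℕ → Bool
xadj ks a b = sameBlock 0 ks a b ∧ not ((a % 2) ≡ᵇ (b % 2))

eqᶠ : {k : ℕ} → Fin k → Fin k → Bool
eqᶠ i j = ⌊ i ≟ᶠ j ⌋

-- z_{c+1} ~ y_{2c+1}, y_{2c+2}  (0-based: y indices 2c and 2c+1)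
zy : {n : ℕ} → Fin n → Fin (2 * n) → Bool
zy c b = (toℕ b ≡ᵇ 2 * toℕ c) ∨ (toℕ b ≡ᵇ suc (2 * toℕ c))

Dadjᵀ : (n : ℕ) → List ℕ → VType n → VType n → Bool
Dadjᵀ n ks (Z c) (Z c') = not (eqᶠ c c')
Dadjᵀ n ks (X a) (X b) = xadj ks (toℕ a) (toℕ b)
Dadjᵀ n ks (X a) (Y b) = eqᶠ a b
Dadjᵀ n ks (Y b) (X a) = eqᶠ a b
Dadjᵀ n ks (Z c) (Y b) = zy c b
Dadjᵀ n ks (Y b) (Z c) = zy c b
Dadjᵀ n ks _ _ = false

Dadj : (n : ℕ) → List ℕ → Fin (2 * n + (2 * n + n)) → Fin (2 * n + (2 * n + n)) → Bool
Dadj n ks u v = Dadjᵀ n ks (decode n u) (decode n v)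

module Submission where

-- With 0-based indices G consists of the n pieces
-- {x_{2c}, x_{2c+1}, y_{2c}, y_{2c+1}, z_c}; the x-vertices form one complete
-- bipartite graph per block (split by parity), the z-vertices a clique.
--
-- Decomposability: by an induction principle proved for arbitrary graphs
-- (GraphFacts) it suffices to find an invariant of vertex sets S such that
-- every well-covered G[S] with an edge has a vertex x for which G[S] \ x is
-- well-covered and G[S] \ x, G[S] \ N[x] satisfy the invariant.  Ours:
-- S contains all x- and y-vertices ("complete"; well-covered since every
-- maximal independent set meets each piece in two vertices), or S has no
-- z-vertex and at most two x-vertices without their y-partner ("reduced").
-- Non-domination: a maximal independent set avoiding u and a smaller one
-- dominating G \ u show that G \ u is not well-covered; this rules out x_0,
-- y_0 and the x-neighbours of x_0 as shedding vertices.

open import Defs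
open import Data.Nat
  using (ℕ; zero; suc; _+_; _*_; _≤_; _<_; _≡ᵇ_; _%_; _/_; _<?_; z≤n; s≤s) renaming (_≟_ to _≟ⁿ_)
open import Data.Nat.Properties
  using (≤-refl; ≤-trans; <-≤-trans; <-trans; <⇒≱; ≮⇒≥; m≤m+n; n≤1+n; n<1+n; 1+n≢n; 1+n≢0; suc-injective;
         +-assoc; +-identityʳ; *-comm; *-suc; *-monoʳ-≤; *-monoʳ-<; *-cancelˡ-<; *-cancelˡ-≡;
         ≤ᵇ⇒≤; ≤⇒≤ᵇ; <ᵇ⇒<; <⇒<ᵇ; ≡ᵇ⇒≡; ≡⇒≡ᵇ; +-0-commutativeMonoid)
open import Data.Nat.DivMod using (m%n<n; m*n%n≡0; [m+kn]%n≡m%n; m≡m%n+[m/n]*n)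
open import Data.Nat.ListAction using (sum)
open import Algebra.Properties.CommutativeMonoid.Sum +-0-commutativeMonoid
  using (sum-cong-≗; ∑-distrib-+) renaming (sum to ∑)
open import Data.Bool using (Bool; true; false; _∧_; _∨_; not; T)
open import Data.Bool.Properties using (T-∧; T-∨; T-≡; T?; ∧-comm; ∧-zeroʳ)
open import Data.Fin using (Fin; zero; suc; toℕ; fromℕ<; splitAt; _↑ˡ_; _↑ʳ_) renaming (_≟_ to _≟ᶠ_)
open import Data.Fin.Properties
  using (any?; toℕ-fromℕ<; fromℕ<-toℕ; toℕ<n; toℕ-injective; splitAt-↑ˡ; splitAt-↑ʳ; splitAt⁻¹-↑ˡ; splitAt⁻¹-↑ʳ)
open import Data.Fin.Subset using (Subset; _∈_; _∉_; _⊆_; _∪_; _─_; ⁅_⁆; ∣_∣; ⊤; inside; outside)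
open import Data.Fin.Subset.Properties
  using (_∈?_; ∈⊤; x∈⁅x⁆; x∈⁅y⁆⇒x≡y; x∈p∪q⁻; p⊆p∪q; q⊆p∪q; ∪-identityʳ; p─q⊆p; x∈p∧x∉q⇒x∈p─q;
         x∈p∧x≢y⇒x∈p-y; x∈p⇒∣p-x∣<∣p∣; p∩q≢∅⇒∣p─q∣<∣p∣; x∈p∩q⁺)
open import Data.List using (List; []; _∷_; length)
open import Data.List.Relation.Unary.All using (All; _∷_)
open import Data.Vec using ([]; _∷_; here; there; lookup; tabulate)
open import Data.Vec.Properties using ([]=⇒lookup; lookup⇒[]=; lookup∘tabulate)
open import Data.Sum using (_⊎_; inj₁; inj₂; [_,_]′)
import Data.Sum as Sum
open import Data.Product using (Σ; _×_; _,_; proj₁; proj₂)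
open import Data.Empty using (⊥; ⊥-elim)
open import Data.Unit using (tt) renaming (⊤ to Unit)
open import Function using (_∘_; Equivalence)
open import Relation.Nullary using (¬_; Dec; yes; no; ¬?)
open import Relation.Nullary.Decidable using (isYes; toWitness; fromWitness; _×-dec_)
open import Relation.Unary using (Decidable)
open import Relation.Binary.PropositionalEquality
  using (_≡_; _≢_; refl; sym; trans; cong; cong₂; subst; subst₂; module ≡-Reasoning)

x∈p─q⇒x∉q : ∀ {m} (p q : Subset m) {x} → x ∈ p ─ q → x ∉ q
x∈p─q⇒x∉q (inside ∷ p) (inside ∷ q) () here
x∈p─q⇒x∉q (outside ∷ p) (inside ∷ q) () here
x∈p─q⇒x∉q (_ ∷ p) (_ ∷ q) (there x∈p─q) (there x∈q) = x∈p─q⇒x∉q p q x∈p─q x∈q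

∣p∪⁅x⁆∣ : ∀ {m} (p : Subset m) x → x ∉ p → ∣ p ∪ ⁅ x ⁆ ∣ ≡ suc ∣ p ∣
∣p∪⁅x⁆∣ (outside ∷ p) zero x∉p rewrite ∪-identityʳ p = refl
∣p∪⁅x⁆∣ (inside ∷ p) zero x∉p = ⊥-elim (x∉p here)
∣p∪⁅x⁆∣ (outside ∷ p) (suc x) x∉p = ∣p∪⁅x⁆∣ p x (λ x∈p → x∉p (there x∈p))
∣p∪⁅x⁆∣ (inside ∷ p) (suc x) x∉p = cong suc (∣p∪⁅x⁆∣ p x (λ x∈p → x∉p (there x∈p)))

module GraphFacts {N : ℕ} (adj : Fin N → Fin N → Bool)
  (adj-sym : ∀ u v → adj u v ≡ adj v u) (adj-irrefl : ∀ v → adj v v ≡ false) where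

  open GraphTheory adj

  Adj-sym : ∀ {u v} → Adj u v → Adj v u
  Adj-sym {u} {v} = subst T (adj-sym u v)

  ¬Adj-refl : ∀ {v} → ¬ Adj v v
  ¬Adj-refl {v} = subst T (adj-irrefl v)

  Adj? : ∀ u v → Dec (Adj u v)
  Adj? u v = T? (adj u v)

  closedNbhd⁺ : ∀ {x v} → v ≡ x ⊎ Adj x v → v ∈ closedNbhd x
  closedNbhd⁺ {x} {v} h = lookup⇒[]= v (closedNbhd x)
    (trans (lookup∘tabulate _ v) (Equivalence.to T-≡ (Equivalence.from T-∨ (Sum.map₁ fromWitness h))))

  closedNbhd⁻ : ∀ {x v} → v ∈ closedNbhd x → v ≡ x ⊎ Adj x v
  closedNbhd⁻ {x} {v} h = Sum.map₁ toWitness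
    (Equivalence.to T-∨ (Equivalence.from T-≡ (trans (sym (lookup∘tabulate _ v)) ([]=⇒lookup h))))

  ∈delete⁺ : ∀ {S x v} → v ∈ S → v ≢ x → v ∈ delete S x
  ∈delete⁺ = x∈p∧x≢y⇒x∈p-y

  ∈delete⁻ : ∀ {S x v} → v ∈ delete S x → v ∈ S × v ≢ x
  ∈delete⁻ {S} {x} h = p─q⊆p S ⁅ x ⁆ h , λ { refl → x∈p─q⇒x∉q S ⁅ x ⁆ h (x∈⁅x⁆ x) }

  ∈deleteNbhd⁺ : ∀ {S x v} → v ∈ S → v ≢ x → ¬ Adj x v → v ∈ deleteNbhd S x
  ∈deleteNbhd⁺ v∈S v≢x ¬adj = x∈p∧x∉q⇒x∈p─q v∈S (λ h → [ v≢x , ¬adj ]′ (closedNbhd⁻ h))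

  ∈deleteNbhd⁻ : ∀ {S x v} → v ∈ deleteNbhd S x → v ∈ S × v ≢ x × ¬ Adj x v
  ∈deleteNbhd⁻ {S} {x} h =
    p─q⊆p S _ h , (λ e → v∉N[x] (closedNbhd⁺ (inj₁ e))) , (λ a → v∉N[x] (closedNbhd⁺ (inj₂ a)))
    where v∉N[x] = x∈p─q⇒x∉q S (closedNbhd x) h

  ∉deleteNbhd : ∀ {S x v} → v ∈ S → v ∉ deleteNbhd S x → v ≡ x ⊎ Adj x v
  ∉deleteNbhd {S} {x} {v} v∈S v∉ with v ≟ᶠ x | Adj? x v
  ... | yes v≡x | _ = inj₁ v≡x
  ... | no _ | yes adj-xv = inj₂ adj-xv
  ... | no v≢x | no ¬adj = ⊥-elim (v∉ (∈deleteNbhd⁺ v∈S v≢x ¬adj))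

  Dominates : Subset N → Subset N → Set
  Dominates S I = ∀ v → v ∈ S → v ∉ I → Σ (Fin N) λ u → u ∈ I × Adj v u

  independent+dominating⇒maximal : ∀ {S I} → Independent S I → Dominates S I → MaximalIndependent S I
  independent+dominating⇒maximal {S} {I} ind dom = ind , λ J J-ind I⊆J {v} v∈J → J⊆I J J-ind I⊆J v v∈J
    where
    J⊆I : ∀ J → Independent S J → I ⊆ J → ∀ v → v ∈ J → v ∈ I
    J⊆I J (J⊆S , J-indep) I⊆J v v∈J with v ∈? I
    ... | yes v∈I = v∈I
    ... | no v∉I with dom v (J⊆S v∈J) v∉I
    ...   | u , u∈I , adj-vu = ⊥-elim (J-indep v u v∈J (I⊆J u∈I) adj-vu)

  independent-insert : ∀ {S I x} → Independent S I → x ∈ S → (∀ u → u ∈ I → ¬ Adj x u) →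
                       Independent S (I ∪ ⁅ x ⁆)
  independent-insert {S} {I} {x} (I⊆S , I-indep) x∈S x⊥I = ⊆S , indep
    where
    cases : ∀ {v} → v ∈ I ∪ ⁅ x ⁆ → v ∈ I ⊎ v ≡ x
    cases h = Sum.map₂ (x∈⁅y⁆⇒x≡y x) (x∈p∪q⁻ I ⁅ x ⁆ h)
    ⊆S : I ∪ ⁅ x ⁆ ⊆ S
    ⊆S h with cases h
    ... | inj₁ v∈I = I⊆S v∈I
    ... | inj₂ refl = x∈S
    indep : ∀ u v → u ∈ I ∪ ⁅ x ⁆ → v ∈ I ∪ ⁅ x ⁆ → ¬ Adj u v
    indep u v hu hv with cases hu | cases hv
    ... | inj₁ u∈I | inj₁ v∈I = I-indep u v u∈I v∈I
    ... | inj₁ u∈I | inj₂ refl = λ a → x⊥I u u∈I (Adj-sym a)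
    ... | inj₂ refl | inj₁ v∈I = x⊥I v v∈I
    ... | inj₂ refl | inj₂ refl = ¬Adj-refl

  -- A maximal independent set dominates: a vertex of S with no neighbour
  -- in I could be added to I.
  maximal⇒dominating : ∀ {S I} → MaximalIndependent S I → Dominates S I
  maximal⇒dominating {S} {I} (ind , maximal) v v∈S v∉I with any? (λ u → (u ∈? I) ×-dec Adj? v u)
  ... | yes found = found
  ... | no none = ⊥-elim (v∉I (maximal (I ∪ ⁅ v ⁆)
          (independent-insert ind v∈S (λ u u∈I a → none (u , u∈I , a)))
          (p⊆p∪q ⁅ v ⁆) (q⊆p∪q I ⁅ v ⁆ (x∈⁅x⁆ v))))

  maximal-delete : ∀ {S I x} → MaximalIndependent S I → x ∉ I → MaximalIndependent (delete S x) I
  maximal-delete m@((I⊆S , I-indep) , _) x∉I = independent+dominating⇒maximal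
    ((λ {v} v∈I → ∈delete⁺ (I⊆S v∈I) (λ { refl → x∉I v∈I })) , I-indep)
    (λ v v∈S-x v∉I → maximal⇒dominating m v (proj₁ (∈delete⁻ v∈S-x)) v∉I)

  maximal-insert : ∀ {S I x} → Independent S I → x ∈ S → (∀ u → u ∈ I → ¬ Adj x u) →
    (∀ v → v ∈ S → v ≢ x → ¬ Adj x v → v ∉ I → Σ (Fin N) λ u → u ∈ I × Adj v u) →
    MaximalIndependent S (I ∪ ⁅ x ⁆)
  maximal-insert {S} {I} {x} ind x∈S x⊥I dom =
    independent+dominating⇒maximal (independent-insert ind x∈S x⊥I) dom′
    where
    x∈I∪x : x ∈ I ∪ ⁅ x ⁆
    x∈I∪x = q⊆p∪q I ⁅ x ⁆ (x∈⁅x⁆ x)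
    dom′ : Dominates S (I ∪ ⁅ x ⁆)
    dom′ v v∈S v∉ with v ≟ᶠ x | Adj? x v
    ... | yes refl | _ = ⊥-elim (v∉ x∈I∪x)
    ... | no _ | yes adj-xv = x , x∈I∪x , Adj-sym adj-xv
    ... | no v≢x | no ¬adj with dom v v∈S v≢x ¬adj (λ v∈I → v∉ (p⊆p∪q ⁅ x ⁆ v∈I))
    ...   | u , u∈I , adj-vu = u , p⊆p∪q ⁅ x ⁆ u∈I , adj-vu

  -- Well-coveredness passes from G[S] to G[S] \ N[x] (for x ∈ S): adding x
  -- to a maximal independent set of G[S] \ N[x] gives one of G[S].
  wellCovered-deleteNbhd : ∀ {S x} → x ∈ S → WellCovered S → WellCovered (deleteNbhd S x)
  wellCovered-deleteNbhd {S} {x} x∈S wc I J mI mJ = suc-injective (begin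
      suc ∣ I ∣        ≡⟨ sym (∣p∪⁅x⁆∣ I x (x∉ mI)) ⟩
      ∣ I ∪ ⁅ x ⁆ ∣    ≡⟨ wc _ _ (lift mI) (lift mJ) ⟩
      ∣ J ∪ ⁅ x ⁆ ∣    ≡⟨ ∣p∪⁅x⁆∣ J x (x∉ mJ) ⟩
      suc ∣ J ∣        ∎)
    where
    open ≡-Reasoning
    x∉ : ∀ {K} → MaximalIndependent (deleteNbhd S x) K → x ∉ K
    x∉ ((K⊆S′ , _) , _) x∈K = proj₁ (proj₂ (∈deleteNbhd⁻ (K⊆S′ x∈K))) refl
    lift : ∀ {K} → MaximalIndependent (deleteNbhd S x) K → MaximalIndependent S (K ∪ ⁅ x ⁆)
    lift m@((K⊆S′ , K-indep) , _) = maximal-insert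
      ((λ u∈K → proj₁ (∈deleteNbhd⁻ (K⊆S′ u∈K))) , K-indep) x∈S
      (λ u u∈K → proj₂ (proj₂ (∈deleteNbhd⁻ (K⊆S′ u∈K))))
      (λ v v∈S v≢x ¬adj → maximal⇒dominating m v (∈deleteNbhd⁺ v∈S v≢x ¬adj))

  -- If x ∈ S has a neighbour y ∈ S each of whose other neighbours in S is a
  -- neighbour of x, then every maximal independent set of G[S] \ x is
  -- maximal in G[S] (it dominates x through y or through y's neighbour);
  -- hence G[S] \ x inherits well-coveredness.
  wellCovered-delete : ∀ {S x y} → x ∈ S → y ∈ S → Adj x y →
    (∀ w → w ∈ S → Adj y w → w ≡ x ⊎ Adj x w) → WellCovered S → WellCovered (delete S x)
  wellCovered-delete {S} {x} {y} x∈S y∈S adj-xy N[y]⊆N[x] wc I J mI mJ = wc I J (lift mI) (lift mJ)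
    where
    y≢x : y ≢ x
    y≢x refl = ¬Adj-refl adj-xy
    lift : ∀ {K} → MaximalIndependent (delete S x) K → MaximalIndependent S K
    lift {K} m@((K⊆S′ , K-indep) , _) =
      independent+dominating⇒maximal ((λ u∈K → proj₁ (∈delete⁻ (K⊆S′ u∈K))) , K-indep) dom
      where
      dom : Dominates S K
      dom v v∈S v∉K with v ≟ᶠ x
      ... | no v≢x = maximal⇒dominating m v (∈delete⁺ v∈S v≢x) v∉K
      ... | yes refl with y ∈? K
      ...   | yes y∈K = y , y∈K , adj-xy
      ...   | no y∉K with maximal⇒dominating m y (∈delete⁺ y∈S y≢x) y∉K
      ...     | u , u∈K , adj-yu with N[y]⊆N[x] u (proj₁ (∈delete⁻ (K⊆S′ u∈K))) adj-yu
      ...       | inj₁ refl = ⊥-elim (proj₂ (∈delete⁻ (K⊆S′ u∈K)) refl)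
      ...       | inj₂ adj-xu = u , u∈K , adj-xu

  -- Then M and I are maximal
  -- in G[S] \ u while M and I ∪ {u} are maximal in G[S], so G[S] and
  -- G[S] \ u are not both well-covered.
  ¬wellCovered-both : ∀ {S u M I} → u ∈ S → MaximalIndependent S M → u ∉ M →
    Independent S I → u ∉ I → (∀ w → w ∈ I → ¬ Adj u w) →
    (∀ v → v ∈ S → v ≢ u → v ∉ I → Σ (Fin N) λ w → w ∈ I × Adj v w) →
    WellCovered S → WellCovered (delete S u) → ⊥
  ¬wellCovered-both {S} {u} {M} {I} u∈S mM u∉M (I⊆S , I-indep) u∉I u⊥I I-dom wc wc-u =
    1+n≢n (begin
      suc ∣ I ∣       ≡⟨ sym (∣p∪⁅x⁆∣ I u u∉I) ⟩
      ∣ I ∪ ⁅ u ⁆ ∣   ≡⟨ wc _ _ mI∪u mM ⟩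
      ∣ M ∣           ≡⟨ wc-u _ _ mM-u mI-u ⟩
      ∣ I ∣           ∎)
    where
    open ≡-Reasoning
    mM-u : MaximalIndependent (delete S u) M
    mM-u = maximal-delete mM u∉M
    mI-u : MaximalIndependent (delete S u) I
    mI-u = independent+dominating⇒maximal
      ((λ {v} v∈I → ∈delete⁺ (I⊆S v∈I) (λ { refl → u∉I v∈I })) , I-indep)
      (λ v v∈S-u → I-dom v (proj₁ (∈delete⁻ v∈S-u)) (proj₂ (∈delete⁻ v∈S-u)))
    mI∪u : MaximalIndependent S (I ∪ ⁅ u ⁆)
    mI∪u = maximal-insert (I⊆S , I-indep) u∈S u⊥I (λ v v∈S v≢u _ → I-dom v v∈S v≢u)

  vertexDecomposable⇒wellCovered : ∀ {S} → VertexDecomposable S → WellCovered S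
  vertexDecomposable⇒wellCovered (vd-empty wc _) = wc
  vertexDecomposable⇒wellCovered (vd-shed wc _ _ _ _) = wc

  SheddingStep : (Subset N → Set) → Subset N → Set
  SheddingStep Good S = NoEdges S ⊎ Σ (Fin N) λ x →
    x ∈ S × WellCovered (delete S x) × Good (delete S x) × Good (deleteNbhd S x)

  -- Induction principle: if every well-covered G[S] satisfying the invariant
  -- admits a shedding step, all of them are vertex decomposable.  (Both
  -- deletions remove x, so the recursion is on the size of S; the
  -- well-coveredness of G[S] \ N[x] is automatic.)
  vertexDecomposable-by : (Good : Subset N → Set) →
    (∀ S → Good S → WellCovered S → SheddingStep Good S) →
    ∀ S → Good S → WellCovered S → VertexDecomposable S
  vertexDecomposable-by Good step S = decompose (suc ∣ S ∣) S ≤-refl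
    where
    x∈N[x] : ∀ {x} → x ∈ closedNbhd x
    x∈N[x] = closedNbhd⁺ (inj₁ refl)
    decompose : ∀ fuel S → ∣ S ∣ < fuel → Good S → WellCovered S → VertexDecomposable S
    decompose zero S ()
    decompose (suc fuel) S (s≤s ∣S∣≤fuel) good wc with step S good wc
    ... | inj₁ no-edges = vd-empty wc no-edges
    ... | inj₂ (x , x∈S , wc-x , good-x , good-N[x]) = vd-shed wc x x∈S
      (decompose fuel _ (<-≤-trans (x∈p⇒∣p-x∣<∣p∣ x∈S) ∣S∣≤fuel) good-x wc-x)
      (decompose fuel _ (<-≤-trans (p∩q≢∅⇒∣p─q∣<∣p∣ S _ (x , x∈p∩q⁺ (x∈S , x∈N[x]))) ∣S∣≤fuel)
        good-N[x] (wellCovered-deleteNbhd x∈S wc))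

indicator : Bool → ℕ
indicator true = 1
indicator false = 0

∣p∣≡∑ : ∀ {m} (p : Subset m) → ∣ p ∣ ≡ ∑ (indicator ∘ lookup p)
∣p∣≡∑ [] = refl
∣p∣≡∑ (inside ∷ p) = cong suc (∣p∣≡∑ p)
∣p∣≡∑ (outside ∷ p) = ∣p∣≡∑ p

sum-↑ : ∀ A {B} (h : Fin (A + B) → ℕ) → ∑ h ≡ ∑ (h ∘ (_↑ˡ B)) + ∑ (h ∘ (A ↑ʳ_))
sum-↑ zero h = refl
sum-↑ (suc A) h = trans (cong (h zero +_) (sum-↑ A (λ a → h (suc a)))) (sym (+-assoc (h zero) _ _))

sum-const : ∀ m k → ∑ {m} (λ _ → k) ≡ m * k
sum-const zero k = refl
sum-const (suc m) k = cong (k +_) (sum-const m k)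

Σ< : ℕ → (ℕ → ℕ) → ℕ
Σ< zero H = 0
Σ< (suc k) H = H 0 + Σ< k (λ i → H (suc i))

Σ<-cong : ∀ k {H H′ : ℕ → ℕ} → (∀ i → H i ≡ H′ i) → Σ< k H ≡ Σ< k H′
Σ<-cong zero H≗H′ = refl
Σ<-cong (suc k) H≗H′ = cong₂ _+_ (H≗H′ 0) (Σ<-cong k (λ i → H≗H′ (suc i)))

Σ<-pairs : ∀ m H → Σ< (2 * m) H ≡ Σ< m (λ c → H (2 * c) + H (suc (2 * c)))
Σ<-pairs zero H = refl
Σ<-pairs (suc m) H = begin
  Σ< (2 * suc m) H                              ≡⟨ cong (λ k → Σ< k H) (*-suc 2 m) ⟩
  H 0 + (H 1 + Σ< (2 * m) (λ i → H (2 + i)))    ≡⟨ sym (+-assoc (H 0) (H 1) _) ⟩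
  H 0 + H 1 + Σ< (2 * m) (λ i → H (2 + i))      ≡⟨ cong (H 0 + H 1 +_) (Σ<-pairs m (λ i → H (2 + i))) ⟩
  H 0 + H 1 + Σ< m (λ c → H (2 + 2 * c) + H (3 + 2 * c))
    ≡⟨ cong (H 0 + H 1 +_) (Σ<-cong m (λ c → cong₂ (λ i j → H i + H j) (sym (*-suc 2 c)) (cong suc (sym (*-suc 2 c))))) ⟩
  H 0 + H 1 + Σ< m (λ c → H (2 * suc c) + H (suc (2 * suc c)))  ∎
  where open ≡-Reasoning

sum≡Σ< : ∀ {k} (h : Fin k → ℕ) H → (∀ a → h a ≡ H (toℕ a)) → ∑ h ≡ Σ< k H
sum≡Σ< {zero} h H h≗H = refl
sum≡Σ< {suc k} h H h≗H = cong₂ _+_ (h≗H zero) (sum≡Σ< (λ a → h (suc a)) (λ i → H (suc i)) (λ a → h≗H (suc a)))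

2c+1<2m : ∀ {c m} → c < m → suc (2 * c) < 2 * m
2c+1<2m {c} {m} c<m = subst (_≤ 2 * m) (*-suc 2 c) (*-monoʳ-≤ 2 c<m)

ev : ∀ {m} → Fin m → Fin (2 * m)
ev {m} c = fromℕ< (*-monoʳ-< 2 (toℕ<n c))

od : ∀ {m} → Fin m → Fin (2 * m)
od c = fromℕ< (2c+1<2m (toℕ<n c))

toℕ-ev : ∀ {m} (c : Fin m) → toℕ (ev c) ≡ 2 * toℕ c
toℕ-ev c = toℕ-fromℕ< _

toℕ-od : ∀ {m} (c : Fin m) → toℕ (od c) ≡ suc (2 * toℕ c)
toℕ-od c = toℕ-fromℕ< _

sum-pairs : ∀ m (h : Fin (2 * m) → ℕ) → ∑ h ≡ ∑ {m} (λ c → h (ev c) + h (od c))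
sum-pairs m h = begin
  ∑ h                                       ≡⟨ sum≡Σ< h H (sym ∘ H-toℕ) ⟩
  Σ< (2 * m) H                              ≡⟨ Σ<-pairs m H ⟩
  Σ< m (λ i → H (2 * i) + H (suc (2 * i)))  ≡⟨ sym (sum≡Σ< {m} (λ c → h (ev c) + h (od c)) _ pair≗) ⟩
  ∑ {m} (λ c → h (ev c) + h (od c))         ∎
  where
  open ≡-Reasoning
  H : ℕ → ℕ
  H i with i <? 2 * m
  ... | yes i<2m = h (fromℕ< i<2m)
  ... | no _ = 0
  H-toℕ : ∀ a → H (toℕ a) ≡ h a
  H-toℕ a with toℕ a <? 2 * m
  ... | yes a<2m = cong h (fromℕ<-toℕ a a<2m)
  ... | no a≮2m = ⊥-elim (a≮2m (toℕ<n a))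
  pair≗ : ∀ (c : Fin m) → h (ev c) + h (od c) ≡ H (2 * toℕ c) + H (suc (2 * toℕ c))
  pair≗ c = cong₂ _+_ (trans (sym (H-toℕ (ev c))) (cong H (toℕ-ev c)))
                      (trans (sym (H-toℕ (od c))) (cong H (toℕ-od c)))

T-not⁺ : ∀ {b} → ¬ T b → T (not b)
T-not⁺ {false} _ = tt
T-not⁺ {true} ¬T = ¬T tt

T-not⁻ : ∀ {b} → T (not b) → ¬ T b
T-not⁻ {false} _ ()

bit : ∀ a → a % 2 ≡ 0 ⊎ a % 2 ≡ 1
bit a with a % 2 | m%n<n a 2
... | 0 | _ = inj₁ refl
... | 1 | _ = inj₂ refl
... | suc (suc _) | s≤s (s≤s ())

parity-third : ∀ a b c → a % 2 ≢ b % 2 → a % 2 ≢ c % 2 → b % 2 ≡ c % 2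
parity-third a b c a≢b a≢c with bit a | bit b | bit c
... | _ | inj₁ b0 | inj₁ c0 = trans b0 (sym c0)
... | _ | inj₂ b1 | inj₂ c1 = trans b1 (sym c1)
... | inj₁ a0 | inj₁ b0 | inj₂ _ = ⊥-elim (a≢b (trans a0 (sym b0)))
... | inj₂ a1 | inj₁ _ | inj₂ c1 = ⊥-elim (a≢c (trans a1 (sym c1)))
... | inj₁ a0 | inj₂ _ | inj₁ c0 = ⊥-elim (a≢c (trans a0 (sym c0)))
... | inj₂ a1 | inj₂ b1 | inj₁ _ = ⊥-elim (a≢b (trans a1 (sym b1)))

even-%2 : ∀ c → (2 * c) % 2 ≡ 0
even-%2 c = trans (cong (_% 2) (*-comm 2 c)) (m*n%n≡0 c 2)

odd-%2 : ∀ c → suc (2 * c) % 2 ≡ 1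
odd-%2 c = trans (cong (λ m → suc m % 2) (*-comm 2 c)) ([m+kn]%n≡m%n 1 c 2)

even≢odd-%2 : ∀ c d → (2 * c) % 2 ≢ suc (2 * d) % 2
even≢odd-%2 c d e with trans (sym (even-%2 c)) (trans e (odd-%2 d))
... | ()

even≢odd : ∀ c d → 2 * c ≢ suc (2 * d)
even≢odd c d e = even≢odd-%2 c d (cong (_% 2) e)

odd-form : ∀ a → a % 2 ≢ 0 → a ≡ suc (2 * (a / 2))
odd-form a a-odd with bit a
... | inj₁ a0 = ⊥-elim (a-odd a0)
... | inj₂ a1 = trans (m≡m%n+[m/n]*n a 2) (cong₂ _+_ a1 (*-comm (a / 2) 2))

≡ᵇ-refl : ∀ a → T (a ≡ᵇ a)
≡ᵇ-refl a = ≡⇒≡ᵇ a a refl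

≡ᵇ-sym : ∀ a b → (a ≡ᵇ b) ≡ (b ≡ᵇ a)
≡ᵇ-sym zero zero = refl
≡ᵇ-sym zero (suc b) = refl
≡ᵇ-sym (suc a) zero = refl
≡ᵇ-sym (suc a) (suc b) = ≡ᵇ-sym a b

inBlock⁺ : ∀ w k {a} → 2 * w ≤ a → a < 2 * (w + k) → T (inBlock w k a)
inBlock⁺ w k {a} lo hi = Equivalence.from T-∧ (≤⇒≤ᵇ lo , <⇒<ᵇ hi)

inBlock⁻ : ∀ w k {a} → T (inBlock w k a) → 2 * w ≤ a × a < 2 * (w + k)
inBlock⁻ w k {a} h with Equivalence.to T-∧ h
... | lo , hi = ≤ᵇ⇒≤ (2 * w) a lo , <ᵇ⇒< a (2 * (w + k)) hi

sameBlock-cases : ∀ w k ks {a b} → T (sameBlock w (k ∷ ks) a b) →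
  (T (inBlock w k a) × T (inBlock w k b)) ⊎ T (sameBlock (w + k) ks a b)
sameBlock-cases w k ks h = Sum.map₁ (Equivalence.to T-∧) (Equivalence.to T-∨ h)

sameBlock-first : ∀ w k ks {a b} → T (inBlock w k a) → T (inBlock w k b) → T (sameBlock w (k ∷ ks) a b)
sameBlock-first w k ks ha hb = Equivalence.from T-∨ (inj₁ (Equivalence.from T-∧ (ha , hb)))

sameBlock-later : ∀ w k ks {a b} → T (sameBlock (w + k) ks a b) → T (sameBlock w (k ∷ ks) a b)
sameBlock-later w k ks h = Equivalence.from T-∨ (inj₂ h)

sameBlock-sym : ∀ w ks a b → sameBlock w ks a b ≡ sameBlock w ks b a
sameBlock-sym w [] a b = refl
sameBlock-sym w (k ∷ ks) a b = cong₂ _∨_ (∧-comm (inBlock w k a) (inBlock w k b)) (sameBlock-sym (w + k) ks a b)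

sameBlock-lower : ∀ w ks {a b} → T (sameBlock w ks a b) → 2 * w ≤ a
sameBlock-lower w [] ()
sameBlock-lower w (k ∷ ks) h with sameBlock-cases w k ks h
... | inj₁ (ha , _) = proj₁ (inBlock⁻ w k ha)
... | inj₂ later = ≤-trans (*-monoʳ-≤ 2 (m≤m+n w k)) (sameBlock-lower (w + k) ks later)

sameBlock-first⁻ : ∀ w k ks {a b} → T (sameBlock w (k ∷ ks) a b) → a < 2 * (w + k) → T (inBlock w k b)
sameBlock-first⁻ w k ks h a<end with sameBlock-cases w k ks h
... | inj₁ (_ , hb) = hb
... | inj₂ later = ⊥-elim (<⇒≱ a<end (sameBlock-lower (w + k) ks later))

sameBlock-trans : ∀ w ks {a b c} → T (sameBlock w ks a b) → T (sameBlock w ks b c) → T (sameBlock w ks a c)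
sameBlock-trans w [] ()
sameBlock-trans w (k ∷ ks) {a} {b} {c} hab hbc with sameBlock-cases w k ks hab | sameBlock-cases w k ks hbc
... | inj₁ (ha , _) | inj₁ (_ , hc) = sameBlock-first w k ks ha hc
... | inj₁ (_ , hb) | inj₂ later = ⊥-elim (<⇒≱ (proj₂ (inBlock⁻ w k hb)) (sameBlock-lower (w + k) ks later))
... | inj₂ later | inj₁ (hb , _) =
  ⊥-elim (<⇒≱ (proj₂ (inBlock⁻ w k hb)) (sameBlock-lower (w + k) ks (subst T (sameBlock-sym (w + k) ks a b) later)))
... | inj₂ later | inj₂ later′ = sameBlock-later w k ks (sameBlock-trans (w + k) ks later later′)

sameBlock-pair : ∀ w ks c → 2 * w ≤ 2 * c → suc (2 * c) < 2 * (w + sum ks) →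
  T (sameBlock w ks (2 * c) (suc (2 * c)))
sameBlock-pair w [] c lo hi =
  ⊥-elim (<⇒≱ (subst (λ m → suc (2 * c) < 2 * m) (+-identityʳ w) hi) (≤-trans lo (n≤1+n _)))
sameBlock-pair w (k ∷ ks) c lo hi with 2 * c <? 2 * (w + k)
... | yes 2c<end = sameBlock-first w k ks (inBlock⁺ w k lo 2c<end) (inBlock⁺ w k (≤-trans lo (n≤1+n _)) 2c+1<end)
  where
  2c+1<end : suc (2 * c) < 2 * (w + k)
  2c+1<end = subst (_≤ 2 * (w + k)) (*-suc 2 c) (*-monoʳ-≤ 2 (*-cancelˡ-< 2 c (w + k) 2c<end))
... | no 2c≮end = sameBlock-later w k ks (sameBlock-pair (w + k) ks c (≮⇒≥ 2c≮end)
                    (subst (λ m → suc (2 * c) < 2 * m) (sym (+-assoc w k (sum ks))) hi))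

xadj⁺ : ∀ ks {a b} → T (sameBlock 0 ks a b) → a % 2 ≢ b % 2 → T (xadj ks a b)
xadj⁺ ks same-block a≢b = Equivalence.from T-∧ (same-block , T-not⁺ (λ h → a≢b (≡ᵇ⇒≡ _ _ h)))

xadj⁻ : ∀ ks {a b} → T (xadj ks a b) → T (sameBlock 0 ks a b) × a % 2 ≢ b % 2
xadj⁻ ks h with Equivalence.to T-∧ h
... | same-block , differ = same-block , λ e → T-not⁻ differ (≡⇒≡ᵇ _ _ e)

xadj-sym : ∀ ks a b → xadj ks a b ≡ xadj ks b a
xadj-sym ks a b = cong₂ (λ x y → x ∧ not y) (sameBlock-sym 0 ks a b) (≡ᵇ-sym (a % 2) (b % 2))

xadj-irrefl : ∀ ks a → xadj ks a a ≡ false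
xadj-irrefl ks a with a % 2 ≡ᵇ a % 2 | ≡ᵇ-refl (a % 2)
... | true | _ = ∧-zeroʳ (sameBlock 0 ks a a)

-- In a disjoint union of complete bipartite graphs, if p ~ q, then any
-- neighbour of p is adjacent to any neighbour of q.
xadj-square : ∀ ks {p q t t′} → T (xadj ks p q) → T (xadj ks p t) → T (xadj ks q t′) → T (xadj ks t t′)
xadj-square ks {p} {q} {t} {t′} p~q p~t q~t′ with xadj⁻ ks p~q | xadj⁻ ks p~t | xadj⁻ ks q~t′
... | pq-block , p≢q | pt-block , p≢t | qt′-block , q≢t′ = xadj⁺ ks
  (sameBlock-trans 0 ks (sameBlock-trans 0 ks (subst T (sameBlock-sym 0 ks p t) pt-block) pq-block) qt′-block)
  (λ t≡t′ → q≢t′ (trans (parity-third p q t p≢q p≢t) t≡t′))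

eqᶠ-sym : ∀ {k} (i j : Fin k) → eqᶠ i j ≡ eqᶠ j i
eqᶠ-sym i j with i ≟ᶠ j | j ≟ᶠ i
... | yes _ | yes _ = refl
... | no _ | no _ = refl
... | yes i≡j | no j≢i = ⊥-elim (j≢i (sym i≡j))
... | no i≢j | yes j≡i = ⊥-elim (i≢j (sym j≡i))

eqᶠ-refl : ∀ {k} (i : Fin k) → eqᶠ i i ≡ true
eqᶠ-refl i with i ≟ᶠ i
... | yes _ = refl
... | no i≢i = ⊥-elim (i≢i refl)

ev-injective : ∀ {m} {c d : Fin m} → ev c ≡ ev d → c ≡ d
ev-injective {c = c} {d} e =
  toℕ-injective (*-cancelˡ-≡ _ _ 2 (trans (sym (toℕ-ev c)) (trans (cong toℕ e) (toℕ-ev d))))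

od-injective : ∀ {m} {c d : Fin m} → od c ≡ od d → c ≡ d
od-injective {c = c} {d} e =
  toℕ-injective (*-cancelˡ-≡ _ _ 2 (suc-injective (trans (sym (toℕ-od c)) (trans (cong toℕ e) (toℕ-od d)))))

ev≢od : ∀ {m} (c d : Fin m) → ev c ≢ od d
ev≢od c d e = even≢odd (toℕ c) (toℕ d) (trans (sym (toℕ-ev c)) (trans (cong toℕ e) (toℕ-od d)))

zy⁺ : ∀ {m} {c : Fin m} {b} → b ≡ ev c ⊎ b ≡ od c → T (zy c b)
zy⁺ {c = c} (inj₁ refl) = Equivalence.from T-∨ (inj₁ (≡⇒≡ᵇ _ _ (toℕ-ev c)))
zy⁺ {c = c} (inj₂ refl) = Equivalence.from T-∨ (inj₂ (≡⇒≡ᵇ _ _ (toℕ-od c)))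

zy⁻ : ∀ {m} {c : Fin m} {b} → T (zy c b) → b ≡ ev c ⊎ b ≡ od c
zy⁻ {c = c} {b} h = Sum.map
  (λ e → toℕ-injective (trans (≡ᵇ⇒≡ _ _ e) (sym (toℕ-ev c))))
  (λ e → toℕ-injective (trans (≡ᵇ⇒≡ _ _ e) (sym (toℕ-od c))))
  (Equivalence.to T-∨ h)

zy-unique : ∀ {m} {c d : Fin m} {b} → T (zy d b) → b ≡ ev c ⊎ b ≡ od c → d ≡ c
zy-unique {c = c} {d} {b} h b∈pair with zy⁻ {c = d} {b} h | b∈pair
... | inj₁ refl | inj₁ e = ev-injective e
... | inj₂ refl | inj₂ e = od-injective e
... | inj₁ refl | inj₂ e = ⊥-elim (ev≢od d c e)
... | inj₂ refl | inj₁ e = ⊥-elim (ev≢od c d (sym e))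

module DGraph (n : ℕ) (ks : List ℕ) where

  N : ℕ
  N = 2 * n + (2 * n + n)

  enc : VType n → Fin N
  enc (X a) = a ↑ˡ (2 * n + n)
  enc (Y b) = (2 * n) ↑ʳ (b ↑ˡ n)
  enc (Z c) = (2 * n) ↑ʳ ((2 * n) ↑ʳ c)

  decode-enc : ∀ t → decode n (enc t) ≡ t
  decode-enc (X a) rewrite splitAt-↑ˡ (2 * n) a (2 * n + n) = refl
  decode-enc (Y b) rewrite splitAt-↑ʳ (2 * n) (2 * n + n) (b ↑ˡ n) | splitAt-↑ˡ (2 * n) b n = refl
  decode-enc (Z c) rewrite splitAt-↑ʳ (2 * n) (2 * n + n) ((2 * n) ↑ʳ c) | splitAt-↑ʳ (2 * n) n c = refl

  enc-decode : ∀ v → enc (decode n v) ≡ v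
  enc-decode v with splitAt (2 * n) v in eq
  ... | inj₁ a = splitAt⁻¹-↑ˡ eq
  ... | inj₂ r with splitAt (2 * n) r in eq′
  ...   | inj₁ b = trans (cong ((2 * n) ↑ʳ_) (splitAt⁻¹-↑ˡ eq′)) (splitAt⁻¹-↑ʳ eq)
  ...   | inj₂ c = trans (cong ((2 * n) ↑ʳ_) (splitAt⁻¹-↑ʳ eq′)) (splitAt⁻¹-↑ʳ eq)

  enc-injective : ∀ {s t} → enc s ≡ enc t → s ≡ t
  enc-injective {s} {t} e = trans (sym (decode-enc s)) (trans (cong (decode n) e) (decode-enc t))

  typed : ∀ v → Σ (VType n) λ t → v ≡ enc t
  typed v = decode n v , sym (enc-decode v)

  Y≢X : ∀ {b a} → enc (Y b) ≢ enc (X a)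
  Y≢X {b} {a} e with enc-injective {Y b} {X a} e
  ... | ()

  X≢Z : ∀ {a c} → enc (X a) ≢ enc (Z c)
  X≢Z {a} {c} e with enc-injective {X a} {Z c} e
  ... | ()

  Y≢Z : ∀ {b c} → enc (Y b) ≢ enc (Z c)
  Y≢Z {b} {c} e with enc-injective {Y b} {Z c} e
  ... | ()

  Dadjᵀ-sym : ∀ s t → Dadjᵀ n ks s t ≡ Dadjᵀ n ks t s
  Dadjᵀ-sym (X a) (X b) = xadj-sym ks (toℕ a) (toℕ b)
  Dadjᵀ-sym (X a) (Y b) = refl
  Dadjᵀ-sym (X a) (Z c) = refl
  Dadjᵀ-sym (Y b) (X a) = refl
  Dadjᵀ-sym (Y b) (Y b′) = refl
  Dadjᵀ-sym (Y b) (Z c) = refl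
  Dadjᵀ-sym (Z c) (X a) = refl
  Dadjᵀ-sym (Z c) (Y b) = refl
  Dadjᵀ-sym (Z c) (Z d) = cong not (eqᶠ-sym c d)

  Dadjᵀ-irrefl : ∀ t → Dadjᵀ n ks t t ≡ false
  Dadjᵀ-irrefl (X a) = xadj-irrefl ks (toℕ a)
  Dadjᵀ-irrefl (Y b) = refl
  Dadjᵀ-irrefl (Z c) = cong not (eqᶠ-refl c)

  open GraphTheory (Dadj n ks) public
  open GraphFacts (Dadj n ks) (λ u v → Dadjᵀ-sym (decode n u) (decode n v))
                              (λ v → Dadjᵀ-irrefl (decode n v)) public

  -- Adjacency of typed vertices, wrapping the defining clauses of Dadjᵀ
  -- (the wrapper lets the endpoints be inferred from the type).
  record _~_ (s t : VType n) : Set where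
    constructor edge
    field holds : T (Dadjᵀ n ks s t)
  open _~_ public

  Dadj-enc : ∀ s t → Dadj n ks (enc s) (enc t) ≡ Dadjᵀ n ks s t
  Dadj-enc s t rewrite decode-enc s | decode-enc t = refl

  Adj⇒~ : ∀ {s t} → Adj (enc s) (enc t) → s ~ t
  Adj⇒~ {s} {t} a = edge (subst T (Dadj-enc s t) a)

  ~⇒Adj : ∀ {s t} → s ~ t → Adj (enc s) (enc t)
  ~⇒Adj {s} {t} (edge h) = subst T (sym (Dadj-enc s t)) h

  ~-sym : ∀ {s t} → s ~ t → t ~ s
  ~-sym {s} {t} (edge h) = edge (subst T (Dadjᵀ-sym s t) h)

  ~-irrefl : ∀ {t} → ¬ t ~ t
  ~-irrefl {t} (edge h) = subst T (Dadjᵀ-irrefl t) h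

  X~Y⁻ : ∀ {a b} → X a ~ Y b → a ≡ b
  X~Y⁻ (edge h) = toWitness h

  Y~X⁻ : ∀ {a b} → Y b ~ X a → a ≡ b
  Y~X⁻ (edge h) = toWitness h

  X~Y : ∀ {a} → X a ~ Y a
  X~Y = edge (fromWitness refl)

  Y~X : ∀ {a} → Y a ~ X a
  Y~X = edge (fromWitness refl)

  Z~Y : ∀ c {b} → b ≡ ev c ⊎ b ≡ od c → Z c ~ Y b
  Z~Y c b∈pair = edge (zy⁺ {c = c} b∈pair)

  Z~Y⁻ : ∀ {c b} → Z c ~ Y b → b ≡ ev c ⊎ b ≡ od c
  Z~Y⁻ {c} {b} (edge h) = zy⁻ {c = c} {b} h

  Y~Z-unique : ∀ {b c d} → Y b ~ Z d → b ≡ ev c ⊎ b ≡ od c → d ≡ c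
  Y~Z-unique {b} {c} {d} (edge h) = zy-unique {c = c} {d} {b} h

  X-square : ∀ {p q t t′} → X p ~ X q → X p ~ X t → X q ~ X t′ → X t ~ X t′
  X-square (edge p~q) (edge p~t) (edge q~t′) = edge (xadj-square ks p~q p~t q~t′)

  ¬X~X-parity : ∀ {p q} → toℕ p % 2 ≡ toℕ q % 2 → ¬ X p ~ X q
  ¬X~X-parity p≡q (edge h) = proj₂ (xadj⁻ ks h) p≡q

  ¬ev~ev : ∀ {c d : Fin n} → ¬ X (ev c) ~ X (ev d)
  ¬ev~ev {c} {d} = ¬X~X-parity (trans (cong (_% 2) (toℕ-ev c))
    (trans (even-%2 (toℕ c)) (sym (trans (cong (_% 2) (toℕ-ev d)) (even-%2 (toℕ d))))))

  ¬od~od : ∀ {c d : Fin n} → ¬ X (od c) ~ X (od d)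
  ¬od~od {c} {d} = ¬X~X-parity (trans (cong (_% 2) (toℕ-od c))
    (trans (odd-%2 (toℕ c)) (sym (trans (cong (_% 2) (toℕ-od d)) (odd-%2 (toℕ d))))))

  Z~Z : ∀ {c d} → c ≢ d → Z c ~ Z d
  Z~Z c≢d = edge (T-not⁺ (λ h → c≢d (toWitness h)))

  independent-~ : ∀ {S I s t} → Independent S I → s ~ t → enc s ∈ I → enc t ∈ I → ⊥
  independent-~ (_ , indep) s~t s∈I t∈I = indep _ _ s∈I t∈I (~⇒Adj s~t)

  dominated-~ : ∀ {S I s} → MaximalIndependent S I → enc s ∈ S → enc s ∉ I →
                Σ (VType n) λ t → enc t ∈ I × s ~ t
  dominated-~ {S} {I} {s} m s∈S s∉I with maximal⇒dominating m (enc s) s∈S s∉I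
  ... | u , u∈I , s-u with typed u
  ...   | t , refl = t , u∈I , Adj⇒~ s-u

none₂ : T false ⊎ T false → ⊥
none₂ (inj₁ ())
none₂ (inj₂ ())

none₃ : T false ⊎ T false ⊎ T false → ⊥
none₃ (inj₁ ())
none₃ (inj₂ h) = none₂ h

-- Counting on one piece x₀, x₁, y₀, y₁, z of D_n (edges x₀y₀, x₁y₁, zy₀,
-- zy₁, x₀x₁), given the membership bits of a maximal independent set:
-- independence on these five edges and domination of y₀, y₁ and (when z
-- is chosen) of x₀, x₁ force exactly two chosen vertices.
piece-count : ∀ x₀ x₁ y₀ y₁ z →
  (T x₀ → T y₀ → ⊥) → (T x₁ → T y₁ → ⊥) → (T z → T y₀ → ⊥) → (T z → T y₁ → ⊥) → (T x₀ → T x₁ → ⊥) →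
  T y₀ ⊎ T x₀ ⊎ T z → T y₁ ⊎ T x₁ ⊎ T z → (T z → T x₀ ⊎ T x₁) →
  indicator x₀ + indicator x₁ + (indicator y₀ + indicator y₁ + indicator z) ≡ 2
piece-count true  _     true  _     _     x₀y₀ _    _    _    _    _  _  _ = ⊥-elim (x₀y₀ tt tt)
piece-count _     true  _     true  _     _    x₁y₁ _    _    _    _  _  _ = ⊥-elim (x₁y₁ tt tt)
piece-count _     _     true  _     true  _    _    zy₀  _    _    _  _  _ = ⊥-elim (zy₀ tt tt)
piece-count _     _     _     true  true  _    _    _    zy₁  _    _  _  _ = ⊥-elim (zy₁ tt tt)
piece-count true  true  _     _     _     _    _    _    _    x₀x₁ _  _  _ = ⊥-elim (x₀x₁ tt tt)
piece-count false false _     _     true  _    _    _    _    _    _  _  z⇒x = ⊥-elim (none₂ (z⇒x tt))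
piece-count false _     false _     false _    _    _    _    _    y₀ _  _ = ⊥-elim (none₃ y₀)
piece-count _     false _     false false _    _    _    _    _    _  y₁ _ = ⊥-elim (none₃ y₁)
piece-count true  false false false true  _    _    _    _    _    _  _  _ = refl
piece-count false true  false false true  _    _    _    _    _    _  _  _ = refl
piece-count true  false false true  false _    _    _    _    _    _  _  _ = refl
piece-count false true  true  false false _    _    _    _    _    _  _  _ = refl
piece-count false false true  true  false _    _    _    _    _    _  _  _ = refl

module Counting (n : ℕ) (ks : List ℕ) (hn : sum ks ≡ n) where

  open DGraph n ks

  Complete : Subset N → Set
  Complete S = ∀ a → enc (X a) ∈ S × enc (Y a) ∈ S

  -- x_{2c} ~ x_{2c+1}: the two members of a pair lie in a common block.
  X-pair : ∀ (c : Fin n) → X (ev c) ~ X (od c)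
  X-pair c = edge (subst₂ (λ p q → T (xadj ks p q)) (sym (toℕ-ev c)) (sym (toℕ-od c))
    (xadj⁺ ks (sameBlock-pair 0 ks (toℕ c) z≤n 2c+1<2n)
              (even≢odd-%2 (toℕ c) (toℕ c))))
    where
    2c+1<2n : suc (2 * toℕ c) < 2 * sum ks
    2c+1<2n = subst₂ _<_ (toℕ-od c) (cong (2 *_) (sym hn)) (toℕ<n (od c))

  mem : Subset N → VType n → Bool
  mem I t = lookup I (enc t)

  mem⁺ : ∀ {I} t → enc t ∈ I → T (mem I t)
  mem⁺ t t∈I = Equivalence.from T-≡ ([]=⇒lookup t∈I)

  mem⁻ : ∀ {I} t → T (mem I t) → enc t ∈ I
  mem⁻ {I} t h = lookup⇒[]= (enc t) I (Equivalence.to T-≡ h)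

  piece-maximal : ∀ {S I} → Complete S → MaximalIndependent S I → ∀ c →
    indicator (mem I (X (ev c))) + indicator (mem I (X (od c))) +
    (indicator (mem I (Y (ev c))) + indicator (mem I (Y (od c))) + indicator (mem I (Z c))) ≡ 2
  piece-maximal {S} {I} complete m c = piece-count _ _ _ _ _
    (excl X~Y) (excl X~Y) (excl (Z~Y c (inj₁ refl))) (excl (Z~Y c (inj₂ refl))) (excl (X-pair c))
    (y-covered (inj₁ refl)) (y-covered (inj₂ refl)) x-covered
    where
    excl : ∀ {s t} → s ~ t → T (mem I s) → T (mem I t) → ⊥
    excl {s} {t} s~t s∈I t∈I = independent-~ (proj₁ m) s~t (mem⁻ s s∈I) (mem⁻ t t∈I)
    y-covered : ∀ {b} → b ≡ ev c ⊎ b ≡ od c → T (mem I (Y b)) ⊎ T (mem I (X b)) ⊎ T (mem I (Z c))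
    y-covered {b} b∈pair with T? (mem I (Y b))
    ... | yes y∈I = inj₁ y∈I
    ... | no y∉I with dominated-~ m (proj₂ (complete b)) (λ y∈I → y∉I (mem⁺ (Y b) y∈I))
    ...   | X a , x∈I , y~x with Y~X⁻ {a} {b} y~x
    ...     | refl = inj₂ (inj₁ (mem⁺ (X b) x∈I))
    y-covered {b} b∈pair | no _ | Z d , z∈I , y~z with Y~Z-unique {c = c} y~z b∈pair
    ...     | refl = inj₂ (inj₂ (mem⁺ (Z c) z∈I))
    -- If z_c is chosen, an unchosen x_b (b in the pair) is dominated by
    -- another x-vertex, as y_b is not chosen.
    x-dominator : ∀ {b} → b ≡ ev c ⊎ b ≡ od c → T (mem I (Z c)) → ¬ T (mem I (X b)) →
                  Σ (Fin (2 * n)) λ a → T (mem I (X a)) × X b ~ X a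
    x-dominator {b} b∈pair z∈I x∉I with dominated-~ m (proj₁ (complete b)) (λ x∈I → x∉I (mem⁺ (X b) x∈I))
    ... | X a , a∈I , b~a = a , mem⁺ (X a) a∈I , b~a
    ... | Y b′ , y∈I , x~y with X~Y⁻ {b} {b′} x~y
    ...   | refl = ⊥-elim (excl (Z~Y c b∈pair) z∈I (mem⁺ (Y b) y∈I))
    x-covered : T (mem I (Z c)) → T (mem I (X (ev c))) ⊎ T (mem I (X (od c)))
    x-covered z∈I with T? (mem I (X (ev c))) | T? (mem I (X (od c)))
    ... | yes e∈I | _ = inj₁ e∈I
    ... | no _ | yes o∈I = inj₂ o∈I
    ... | no e∉I | no o∉I with x-dominator (inj₁ refl) z∈I e∉I | x-dominator (inj₂ refl) z∈I o∉I
    ...   | a , a∈I , e~a | a′ , a′∈I , o~a′ = ⊥-elim (excl (X-square (X-pair c) e~a o~a′) a∈I a′∈I)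

  card-maximal : ∀ {S I} → Complete S → MaximalIndependent S I → ∣ I ∣ ≡ n * 2
  card-maximal {S} {I} complete m = begin
    ∣ I ∣                                      ≡⟨ ∣p∣≡∑ I ⟩
    ∑ (indicator ∘ lookup I)                   ≡⟨ sum-↑ (2 * n) _ ⟩
    ∑ bx + ∑ (λ r → indicator (lookup I ((2 * n) ↑ʳ r)))
                                               ≡⟨ cong (∑ bx +_) (sum-↑ (2 * n) _) ⟩
    ∑ bx + (∑ by + ∑ bz)                       ≡⟨ cong₂ (λ p q → p + (q + ∑ bz)) (sum-pairs n bx) (sum-pairs n by) ⟩
    ∑ pair-x + (∑ pair-y + ∑ bz)               ≡⟨ cong (∑ pair-x +_) (sym (∑-distrib-+ pair-y bz)) ⟩
    ∑ pair-x + ∑ (λ c → pair-y c + bz c)       ≡⟨ sym (∑-distrib-+ pair-x _) ⟩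
    ∑ (λ c → pair-x c + (pair-y c + bz c))     ≡⟨ sum-cong-≗ (piece-maximal complete m) ⟩
    ∑ {n} (λ _ → 2)                            ≡⟨ sum-const n 2 ⟩
    n * 2                                      ∎
    where
    open ≡-Reasoning
    bx by : Fin (2 * n) → ℕ
    bx a = indicator (mem I (X a))
    by b = indicator (mem I (Y b))
    bz : Fin n → ℕ
    bz c = indicator (mem I (Z c))
    pair-x pair-y : Fin n → ℕ
    pair-x c = bx (ev c) + bx (od c)
    pair-y c = by (ev c) + by (od c)

  wellCovered-complete : ∀ {S} → Complete S → WellCovered S
  wellCovered-complete complete I J mI mJ = trans (card-maximal complete mI) (sym (card-maximal complete mJ))

pigeonhole : ∀ {A : Set} {p q a b d : A} → a ≡ p ⊎ a ≡ q → b ≡ p ⊎ b ≡ q → d ≡ p ⊎ d ≡ q →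
             a ≡ b ⊎ a ≡ d ⊎ b ≡ d
pigeonhole (inj₁ refl) (inj₁ refl) _ = inj₁ refl
pigeonhole (inj₂ refl) (inj₂ refl) _ = inj₁ refl
pigeonhole (inj₁ refl) (inj₂ refl) (inj₁ refl) = inj₂ (inj₁ refl)
pigeonhole (inj₁ refl) (inj₂ refl) (inj₂ refl) = inj₂ (inj₂ refl)
pigeonhole (inj₂ refl) (inj₁ refl) (inj₁ refl) = inj₂ (inj₂ refl)
pigeonhole (inj₂ refl) (inj₁ refl) (inj₂ refl) = inj₂ (inj₁ refl)

-- Vertex decomposability of D_n(k₁, ..., k_m), by shedding first the
-- z-vertices (keeping all x- and y-vertices: the counting argument gives
-- well-coveredness), and then x-vertices of sets without z-vertices.
module Decomposition (n : ℕ) (ks : List ℕ) (hn : sum ks ≡ n) where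

  open DGraph n ks
  open Counting n ks hn

  Lacking : Subset N → Fin (2 * n) → Set
  Lacking S a = enc (X a) ∈ S × enc (Y a) ∉ S

  Reduced : Subset N → Set
  Reduced S = (∀ c → enc (Z c) ∉ S) ×
              (∀ {a b d} → Lacking S a → Lacking S b → Lacking S d → a ≡ b ⊎ a ≡ d ⊎ b ≡ d)

  Good : Subset N → Set
  Good S = Complete S ⊎ Reduced S

  reduced-shrink : ∀ {S S′} → Reduced S → S′ ⊆ S →
    (∀ b → enc (Y b) ∈ S → enc (Y b) ∉ S′ → enc (X b) ∉ S′) → Reduced S′
  reduced-shrink {S} {S′} (no-z , two) S′⊆S partner = (λ c z∈S′ → no-z c (S′⊆S z∈S′)) ,
    λ la lb ld → two (lacking la) (lacking lb) (lacking ld)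
    where
    lacking : ∀ {a} → Lacking S′ a → Lacking S a
    lacking (x∈S′ , y∉S′) = S′⊆S x∈S′ , λ y∈S → partner _ y∈S y∉S′ x∈S′

  reduced-delete-X : ∀ {S} → Reduced S → ∀ a → Reduced (delete S (enc (X a)))
  reduced-delete-X {S} red a = reduced-shrink red (p─q⊆p S _) λ b y∈S y∉ _ → y∉ (∈delete⁺ y∈S Y≢X)

  -- G[S] \ N[x_a] loses only the y-vertex y_a, together with x_a.
  reduced-deleteNbhd-X : ∀ {S} → Reduced S → ∀ a → Reduced (deleteNbhd S (enc (X a)))
  reduced-deleteNbhd-X {S} red a = reduced-shrink red (p─q⊆p S _) partner
    where
    partner : ∀ b → enc (Y b) ∈ S → enc (Y b) ∉ deleteNbhd S (enc (X a)) → enc (X b) ∉ deleteNbhd S (enc (X a))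
    partner b y∈S y∉ x∈ with ∉deleteNbhd y∈S y∉
    ... | inj₁ y≡x = Y≢X y≡x
    ... | inj₂ x-y with X~Y⁻ (Adj⇒~ x-y)
    ...   | refl = proj₁ (proj₂ (∈deleteNbhd⁻ x∈)) refl

  -- Shedding steps for reduced sets: shed an x-vertex whose partner is
  -- present (its only neighbour), otherwise an endpoint x_a of an edge
  -- x_a x_b (all neighbours of x_b in S are then x_a).
  step-reduced : ∀ S → Reduced S → WellCovered S → SheddingStep Good S
  step-reduced S red@(no-z , two) wc with any? (λ a → (enc (X a) ∈? S) ×-dec (enc (Y a) ∈? S))
  ... | yes (a , x∈S , y∈S) = inj₂ (enc (X a) , x∈S ,
          wellCovered-delete x∈S y∈S (~⇒Adj X~Y) N[y]⊆N[x] wc ,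
          inj₂ (reduced-delete-X red a) , inj₂ (reduced-deleteNbhd-X red a))
    where
    N[y]⊆N[x] : ∀ w → w ∈ S → Adj (enc (Y a)) w → w ≡ enc (X a) ⊎ Adj (enc (X a)) w
    N[y]⊆N[x] w w∈S y-w with typed w
    ... | X b , refl = inj₁ (cong (λ b → enc (X b)) (Y~X⁻ (Adj⇒~ y-w)))
    ... | Y b , refl = ⊥-elim (holds (Adj⇒~ {Y a} {Y b} y-w))
    ... | Z c , refl = ⊥-elim (no-z c w∈S)
  ... | no no-pair with any? (λ u → any? (λ v → (u ∈? S) ×-dec ((v ∈? S) ×-dec Adj? u v)))
  ...   | no no-edge = inj₁ (λ u v u∈S v∈S u-v → no-edge (u , v , u∈S , v∈S , u-v))
  ...   | yes (u , v , u∈S , v∈S , u-v) with typed u | typed v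
  ...     | s , refl | t , refl = shed-edge s t u∈S v∈S (Adj⇒~ u-v)
    where
    lacking : ∀ {a} → enc (X a) ∈ S → Lacking S a
    lacking {a} x∈S = x∈S , λ y∈S → no-pair (a , x∈S , y∈S)
    shed-edge : ∀ s t → enc s ∈ S → enc t ∈ S → s ~ t → SheddingStep Good S
    shed-edge (Z c) _ z∈S _ _ = ⊥-elim (no-z c z∈S)
    shed-edge _ (Z c) _ z∈S _ = ⊥-elim (no-z c z∈S)
    shed-edge (Y b) (Y _) _ _ (edge ())
    shed-edge (X a) (Y b) x∈S y∈S x~y with X~Y⁻ x~y
    ... | refl = ⊥-elim (no-pair (a , x∈S , y∈S))
    shed-edge (Y b) (X a) y∈S x∈S y~x with Y~X⁻ y~x
    ... | refl = ⊥-elim (no-pair (a , x∈S , y∈S))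
    shed-edge (X a) (X b) xa∈S xb∈S a~b = inj₂ (enc (X a) , xa∈S ,
        wellCovered-delete xa∈S xb∈S (~⇒Adj a~b) N[xb]⊆N[xa] wc ,
        inj₂ (reduced-delete-X red a) , inj₂ (reduced-deleteNbhd-X red a))
      where
      N[xb]⊆N[xa] : ∀ w → w ∈ S → Adj (enc (X b)) w → w ≡ enc (X a) ⊎ Adj (enc (X a)) w
      N[xb]⊆N[xa] w w∈S b-w with typed w
      ... | Z c , refl = ⊥-elim (no-z c w∈S)
      ... | Y d , refl with X~Y⁻ (Adj⇒~ b-w)
      ...   | refl = ⊥-elim (no-pair (b , xb∈S , w∈S))
      N[xb]⊆N[xa] w w∈S b-w | X d , refl with two (lacking xa∈S) (lacking xb∈S) (lacking w∈S)
      ... | inj₁ refl = ⊥-elim (~-irrefl a~b)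
      ... | inj₂ (inj₁ refl) = inj₁ refl
      ... | inj₂ (inj₂ refl) = ⊥-elim (~-irrefl (Adj⇒~ {X b} {X b} b-w))

  -- Shedding steps for complete sets: shed a z-vertex z_c; what remains
  -- after deleting N[z_c] lacks only y_{2c} and y_{2c+1}.
  step-complete : ∀ S → Complete S → WellCovered S → SheddingStep Good S
  step-complete S complete wc with any? (λ c → enc (Z c) ∈? S)
  ... | yes (c , z∈S) = inj₂ (enc (Z c) , z∈S , wellCovered-complete complete-z , inj₁ complete-z , inj₂ reduced-N[z])
    where
    complete-z : Complete (delete S (enc (Z c)))
    complete-z a = ∈delete⁺ (proj₁ (complete a)) X≢Z , ∈delete⁺ (proj₂ (complete a)) Y≢Z
    S′ = deleteNbhd S (enc (Z c))
    no-z : ∀ d → enc (Z d) ∉ S′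
    no-z d z∈S′ with d ≟ᶠ c | ∈deleteNbhd⁻ z∈S′
    ... | yes refl | _ , z≢z , _ = z≢z refl
    ... | no d≢c | _ , _ , ¬adj = ¬adj (~⇒Adj (Z~Z (λ c≡d → d≢c (sym c≡d))))
    in-pair : ∀ {a} → Lacking S′ a → a ≡ ev c ⊎ a ≡ od c
    in-pair {a} (_ , y∉S′) with ∉deleteNbhd (proj₂ (complete a)) y∉S′
    ... | inj₁ y≡z = ⊥-elim (Y≢Z y≡z)
    ... | inj₂ z-y = Z~Y⁻ (Adj⇒~ z-y)
    reduced-N[z] : Reduced S′
    reduced-N[z] = no-z , λ la lb ld → pigeonhole (in-pair la) (in-pair lb) (in-pair ld)
  ... | no no-z = step-reduced S ((λ c z∈S → no-z (c , z∈S)) , λ (_ , y∉S) → ⊥-elim (y∉S (proj₂ (complete _)))) wc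

  step : ∀ S → Good S → WellCovered S → SheddingStep Good S
  step S (inj₁ complete) = step-complete S complete
  step S (inj₂ reduced) = step-reduced S reduced

  complete-⊤ : Complete ⊤
  complete-⊤ a = ∈⊤ , ∈⊤

  wellCovered : WellCovered ⊤
  wellCovered = wellCovered-complete complete-⊤

  vertexDecomposable : VertexDecomposable ⊤
  vertexDecomposable = vertexDecomposable-by Good step ⊤ (inj₁ complete-⊤) wellCovered

module Unshedable (n : ℕ) (ks : List ℕ) where

  open DGraph n ks

  ⟦_⟧ : {P : VType n → Set} → Decidable P → Subset N
  ⟦ P? ⟧ = tabulate (λ v → isYes (P? (decode n v)))

  ∈⟦⟧⁺ : ∀ {P} (P? : Decidable P) {t} → P t → enc t ∈ ⟦ P? ⟧
  ∈⟦⟧⁺ P? {t} p = lookup⇒[]= (enc t) ⟦ P? ⟧ (trans (lookup∘tabulate _ (enc t))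
    (Equivalence.to T-≡ (subst (λ s → T (isYes (P? s))) (sym (decode-enc t)) (fromWitness p))))

  ∈⟦⟧⁻ : ∀ {P} (P? : Decidable P) {t} → enc t ∈ ⟦ P? ⟧ → P t
  ∈⟦⟧⁻ P? {t} h = toWitness (subst (λ s → T (isYes (P? s))) (decode-enc t)
    (Equivalence.from T-≡ (trans (sym (lookup∘tabulate _ (enc t))) ([]=⇒lookup h))))

  IndependentP : (VType n → Set) → Set
  IndependentP P = ∀ {s t} → P s → P t → ¬ s ~ t

  DominatesP : (VType n → Set) → (VType n → Set) → Set
  DominatesP P Q = ∀ s → Q s → ¬ P s → Σ (VType n) λ t → P t × s ~ t

  independent-⟦⟧ : ∀ {P} (P? : Decidable P) → IndependentP P → Independent ⊤ ⟦ P? ⟧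
  independent-⟦⟧ P? indep = (λ _ → ∈⊤) , lemma
    where
    lemma : ∀ u v → u ∈ ⟦ P? ⟧ → v ∈ ⟦ P? ⟧ → ¬ Adj u v
    lemma u v u∈ v∈ u-v with typed u | typed v
    ... | s , refl | t , refl = indep (∈⟦⟧⁻ P? u∈) (∈⟦⟧⁻ P? v∈) (Adj⇒~ {s} {t} u-v)

  dominates-⟦⟧ : ∀ {P Q} (P? : Decidable P) → DominatesP P Q →
    ∀ s → Q s → enc s ∉ ⟦ P? ⟧ → Σ (Fin N) λ w → w ∈ ⟦ P? ⟧ × Adj (enc s) w
  dominates-⟦⟧ P? dom s Q-s s∉ with dom s Q-s (λ p → s∉ (∈⟦⟧⁺ P? p))
  ... | t , p , s~t = enc t , ∈⟦⟧⁺ P? p , ~⇒Adj s~t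

  Everything : VType n → Set
  Everything _ = Unit

  ¬shed-by : ∀ u {M I} (M? : Decidable M) (I? : Decidable I) →
    IndependentP M → DominatesP M Everything → ¬ M u →
    IndependentP I → DominatesP I (_≢ u) → ¬ I u → (∀ {t} → I t → ¬ u ~ t) →
    WellCovered ⊤ → ¬ WellCovered (delete ⊤ (enc u))
  ¬shed-by u M? I? M-indep M-dom ¬Mu I-indep I-dom ¬Iu u⊥I =
    ¬wellCovered-both ∈⊤
      (independent+dominating⇒maximal (independent-⟦⟧ M? M-indep) M-dom′) (λ h → ¬Mu (∈⟦⟧⁻ M? h))
      (independent-⟦⟧ I? I-indep) (λ h → ¬Iu (∈⟦⟧⁻ I? h)) u⊥I′ I-dom′
    where
    M-dom′ : Dominates ⊤ ⟦ M? ⟧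
    M-dom′ v _ v∉ with typed v
    ... | s , refl = dominates-⟦⟧ M? M-dom s tt v∉
    I-dom′ : ∀ v → v ∈ ⊤ → v ≢ enc u → v ∉ ⟦ I? ⟧ → Σ (Fin N) λ w → w ∈ ⟦ I? ⟧ × Adj v w
    I-dom′ v _ v≢u v∉ with typed v
    ... | s , refl = dominates-⟦⟧ I? I-dom s (λ s≡u → v≢u (cong enc s≡u)) v∉
    u⊥I′ : ∀ w → w ∈ ⟦ I? ⟧ → ¬ Adj (enc u) w
    u⊥I′ w w∈ u-w with typed w
    ... | t , refl = u⊥I (∈⟦⟧⁻ I? w∈) (Adj⇒~ {u} {t} u-w)

  -- Witnesses:
  -- M = all y-vertices, I = {x_t, z_c} ∪ {y_b : b ∉ {a, a′, t}}.
  ¬shed-X : ∀ {a a′ t c} → (∀ {b} → Z c ~ Y b → b ≡ a ⊎ b ≡ a′) → Z c ~ Y a → Z c ~ Y a′ →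
    t ≢ a → ¬ X a ~ X t → X a′ ~ X t → WellCovered ⊤ → ¬ WellCovered (delete ⊤ (enc (X a)))
  ¬shed-X {a} {a′} {t} {c} z-pair z~a z~a′ t≢a a≁t a′~t =
    ¬shed-by (X a) M? I? M-indep M-dom (λ ()) I-indep I-dom (λ a≡t → t≢a (sym a≡t)) u⊥I
    where
    M : VType n → Set
    M (Y _) = Unit
    M _ = ⊥
    M? : Decidable M
    M? (X _) = no λ ()
    M? (Y _) = yes tt
    M? (Z _) = no λ ()
    M-indep : IndependentP M
    M-indep {Y _} {Y _} _ _ (edge ())
    M-dom : DominatesP M Everything
    M-dom (X b) _ _ = Y b , tt , X~Y
    M-dom (Y b) _ ¬My = ⊥-elim (¬My tt)
    M-dom (Z d) _ _ = Y (ev d) , tt , Z~Y d (inj₁ refl)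
    I : VType n → Set
    I (X b) = b ≡ t
    I (Y b) = b ≢ a × b ≢ a′ × b ≢ t
    I (Z d) = d ≡ c
    I? : Decidable I
    I? (X b) = b ≟ᶠ t
    I? (Y b) = ¬? (b ≟ᶠ a) ×-dec ¬? (b ≟ᶠ a′) ×-dec ¬? (b ≟ᶠ t)
    I? (Z d) = d ≟ᶠ c
    I-indep : IndependentP I
    I-indep {X _} {X _} refl refl t~t = ~-irrefl t~t
    I-indep {X _} {Y b} refl (_ , _ , b≢t) x~y = b≢t (sym (X~Y⁻ x~y))
    I-indep {Y b} {X _} (_ , _ , b≢t) refl y~x = b≢t (sym (Y~X⁻ y~x))
    I-indep {Y b} {Z _} (b≢a , b≢a′ , _) refl y~z = [ b≢a , b≢a′ ]′ (z-pair (~-sym y~z))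
    I-indep {Z _} {Y b} refl (b≢a , b≢a′ , _) z~y = [ b≢a , b≢a′ ]′ (z-pair z~y)
    I-indep {Z _} {Z _} refl refl c~c = ~-irrefl c~c
    I-indep {X _} {Z _} _ _ (edge ())
    I-indep {Z _} {X _} _ _ (edge ())
    I-indep {Y _} {Y _} _ _ (edge ())
    u⊥I : ∀ {s} → I s → ¬ X a ~ s
    u⊥I {X _} refl a~t = a≁t a~t
    u⊥I {Y b} (b≢a , _) a~b = b≢a (sym (X~Y⁻ a~b))
    u⊥I {Z _} _ (edge ())
    I-dom : DominatesP I (_≢ X a)
    I-dom (X b) xb≢xa ¬Ixb with b ≟ᶠ a′
    ... | yes refl = X t , refl , a′~t
    ... | no b≢a′ = Y b , ((λ b≡a → xb≢xa (cong X b≡a)) , b≢a′ , ¬Ixb) , X~Y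
    I-dom (Y b) _ ¬Iyb with b ≟ᶠ t | b ≟ᶠ a | b ≟ᶠ a′
    ... | yes refl | _ | _ = X t , refl , Y~X
    ... | no _ | yes refl | _ = Z c , refl , ~-sym z~a
    ... | no _ | no _ | yes refl = Z c , refl , ~-sym z~a′
    ... | no b≢t | no b≢a | no b≢a′ = ⊥-elim (¬Iyb (b≢a , b≢a′ , b≢t))
    I-dom (Z d) _ d≢c = Z c , refl , Z~Z d≢c

  -- y_a cannot be shed if x_a ~ x_t and every z-vertex has a y-neighbour
  -- other than y_a and y_t.  Witnesses: M = {x_a} ∪ {y_b : b ≠ a},
  -- I = {x_t} ∪ {y_b : b ∉ {a, t}}.
  ¬shed-Y : ∀ {a t} → X a ~ X t → (∀ d → Σ (Fin (2 * n)) λ b → Z d ~ Y b × b ≢ a × b ≢ t) →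
    WellCovered ⊤ → ¬ WellCovered (delete ⊤ (enc (Y a)))
  ¬shed-Y {a} {t} a~t other-y =
    ¬shed-by (Y a) M? I? M-indep M-dom (λ a≢a → a≢a refl) I-indep I-dom (λ (a≢a , _) → a≢a refl) u⊥I
    where
    M : VType n → Set
    M (X b) = b ≡ a
    M (Y b) = b ≢ a
    M (Z _) = ⊥
    M? : Decidable M
    M? (X b) = b ≟ᶠ a
    M? (Y b) = ¬? (b ≟ᶠ a)
    M? (Z _) = no λ ()
    M-indep : IndependentP M
    M-indep {X _} {X _} refl refl a~a = ~-irrefl a~a
    M-indep {X _} {Y b} refl b≢a x~y = b≢a (sym (X~Y⁻ x~y))
    M-indep {Y b} {X _} b≢a refl y~x = b≢a (sym (Y~X⁻ y~x))
    M-indep {Y _} {Y _} _ _ (edge ())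
    M-dom : DominatesP M Everything
    M-dom (X b) _ b≢a = Y b , b≢a , X~Y
    M-dom (Y b) _ ¬b≢a with b ≟ᶠ a
    ... | yes refl = X a , refl , Y~X
    ... | no b≢a = ⊥-elim (¬b≢a b≢a)
    M-dom (Z d) _ _ with other-y d
    ... | b , z~y , b≢a , _ = Y b , b≢a , z~y
    I : VType n → Set
    I (X b) = b ≡ t
    I (Y b) = b ≢ a × b ≢ t
    I (Z _) = ⊥
    I? : Decidable I
    I? (X b) = b ≟ᶠ t
    I? (Y b) = ¬? (b ≟ᶠ a) ×-dec ¬? (b ≟ᶠ t)
    I? (Z _) = no λ ()
    I-indep : IndependentP I
    I-indep {X _} {X _} refl refl t~t = ~-irrefl t~t
    I-indep {X _} {Y b} refl (_ , b≢t) x~y = b≢t (sym (X~Y⁻ x~y))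
    I-indep {Y b} {X _} (_ , b≢t) refl y~x = b≢t (sym (Y~X⁻ y~x))
    I-indep {Y _} {Y _} _ _ (edge ())
    u⊥I : ∀ {s} → I s → ¬ Y a ~ s
    u⊥I {X _} refl y~x with Y~X⁻ y~x
    ... | refl = ~-irrefl a~t
    u⊥I {Y _} _ (edge ())
    I-dom : DominatesP I (_≢ Y a)
    I-dom (X b) _ b≢t with b ≟ᶠ a
    ... | yes refl = X t , refl , a~t
    ... | no b≢a = Y b , (b≢a , b≢t) , X~Y
    I-dom (Y b) yb≢ya ¬Iyb with b ≟ᶠ t
    ... | yes refl = X t , refl , Y~X
    ... | no b≢t = ⊥-elim (¬Iyb ((λ b≡a → yb≢ya (cong Y b≡a)) , b≢t))
    I-dom (Z d) _ _ with other-y d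
    ... | b , z~y , b≢a , b≢t = Y b , (b≢a , b≢t) , z~y

-- The shedding vertices of D_n(k₁, ..., k_m) do not dominate x_{2c} for a
-- pair index c of the first block (k₁ ≥ 2): neither x_{2c}, nor y_{2c},
-- nor any of its x-neighbours x_{2c′+1} can be shed.
module NonDomination (n k : ℕ) (rest : List ℕ) (2≤k : 2 ≤ k) (hn : sum (k ∷ rest) ≡ n) where

  ks : List ℕ
  ks = k ∷ rest

  open DGraph n ks
  open Unshedable n ks
  open Decomposition n ks hn using (wellCovered)

  k≤n : k ≤ n
  k≤n = subst (k ≤_) hn (m≤m+n k (sum rest))

  record First (c : Fin n) : Set where
    constructor first-pair
    field index<k : toℕ c < k

  first : ∀ i → i < k → Σ (Fin n) First
  first i i<k = fromℕ< (<-≤-trans i<k k≤n) , first-pair (subst (_< k) (sym (toℕ-fromℕ< _)) i<k)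

  another : ∀ c → Σ (Fin n) λ c′ → First c′ × c′ ≢ c
  another c with toℕ c ≟ⁿ 0
  ... | yes c≡0 = let (c′ , c′-first) = first 1 2≤k in
                  c′ , c′-first , λ c′≡c → 1+n≢0 (trans (sym (toℕ-fromℕ< _)) (trans (cong toℕ c′≡c) c≡0))
  ... | no c≢0 = let (c′ , c′-first) = first 0 (≤-trans (s≤s z≤n) 2≤k) in
                 c′ , c′-first , λ c′≡c → c≢0 (trans (cong toℕ (sym c′≡c)) (toℕ-fromℕ< _))

  first-block-edge : ∀ {c c′} → First c → First c′ → X (ev c) ~ X (od c′)
  first-block-edge {c} {c′} (first-pair c<k) (first-pair c′<k) =
    edge (subst₂ (λ p q → T (xadj ks p q)) (sym (toℕ-ev c)) (sym (toℕ-od c′))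
      (xadj⁺ ks (sameBlock-first 0 k rest (inBlock⁺ 0 k z≤n (*-monoʳ-< 2 c<k)) (inBlock⁺ 0 k z≤n (2c+1<2m c′<k)))
                (even≢odd-%2 (toℕ c) (toℕ c′))))

  first-block-neighbour : ∀ {c a} → First c → X (ev c) ~ X a → Σ (Fin n) λ c′ → a ≡ od c′ × First c′
  first-block-neighbour {c} {a} (first-pair c<k) (edge h) with xadj⁻ ks h
  ... | same-block , parity =
    c′ , toℕ-injective (trans a-odd (sym (trans (toℕ-od c′) (cong (λ i → suc (2 * i)) toℕ-c′)))) ,
    first-pair (subst (_< k) (sym toℕ-c′) q<k)
    where
    2c<2k : toℕ (ev c) < 2 * k
    2c<2k = subst (_< 2 * k) (sym (toℕ-ev c)) (*-monoʳ-< 2 c<k)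
    a<2k : toℕ a < 2 * k
    a<2k = proj₂ (inBlock⁻ 0 k (sameBlock-first⁻ 0 k rest same-block 2c<2k))
    a-odd : toℕ a ≡ suc (2 * (toℕ a / 2))
    a-odd = odd-form (toℕ a) (λ a0 → parity (trans (cong (_% 2) (toℕ-ev c)) (trans (even-%2 (toℕ c)) (sym a0))))
    q<k : toℕ a / 2 < k
    q<k = *-cancelˡ-< 2 _ _ (<-trans (n<1+n _) (subst (_< 2 * k) a-odd a<2k))
    c′ : Fin n
    c′ = fromℕ< (<-≤-trans q<k k≤n)
    toℕ-c′ : toℕ c′ ≡ toℕ a / 2
    toℕ-c′ = toℕ-fromℕ< _

  not-shed : ∀ {v} → ¬ WellCovered (delete ⊤ v) → ¬ Shed ⊤ v
  not-shed ¬wc (_ , vd , _) = ¬wc (vertexDecomposable⇒wellCovered vd)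

  -- x_{2c}: use a′ = 2c + 1 and t = 2c′ for another first-block pair c′.
  ¬shed-even-X : ∀ {c} → First c → ¬ Shed ⊤ (enc (X (ev c)))
  ¬shed-even-X {c} c-first =
    let (c′ , c′-first , c′≢c) = another c in not-shed (¬shed-X Z~Y⁻ (Z~Y c (inj₁ refl)) (Z~Y c (inj₂ refl))
          (c′≢c ∘ ev-injective) (¬ev~ev {c} {c′}) (~-sym (first-block-edge c′-first c-first)) wellCovered)

  -- x_{2c+1}: use a′ = 2c and t = 2c′ + 1 for another first-block pair c′.
  ¬shed-odd-X : ∀ {c} → First c → ¬ Shed ⊤ (enc (X (od c)))
  ¬shed-odd-X {c} c-first =
    let (c′ , c′-first , c′≢c) = another c in not-shed (¬shed-X (Sum.swap ∘ Z~Y⁻) (Z~Y c (inj₂ refl)) (Z~Y c (inj₁ refl))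
          (c′≢c ∘ od-injective) (¬od~od {c} {c′}) (first-block-edge c-first c′-first) wellCovered)

  -- y_{2c}: use t = 2c′ + 1; z_c has the other neighbour y_{2c+1}, and
  -- z_d (d ≠ c) has y_{2d}.
  ¬shed-even-Y : ∀ {c} → First c → ¬ Shed ⊤ (enc (Y (ev c)))
  ¬shed-even-Y {c} c-first with another c
  ... | c′ , c′-first , c′≢c = not-shed (¬shed-Y (first-block-edge c-first c′-first) other-y wellCovered)
    where
    other-y : ∀ d → Σ (Fin (2 * n)) λ b → Z d ~ Y b × b ≢ ev c × b ≢ od c′
    other-y d with d ≟ᶠ c
    ... | yes refl = od c , Z~Y c (inj₂ refl) , (λ e → ev≢od c c (sym e)) , (λ e → c′≢c (sym (od-injective e)))
    ... | no d≢c = ev d , Z~Y d (inj₁ refl) , (d≢c ∘ ev-injective) , ev≢od d c′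

  ¬shed-neighbour : ∀ {c} t → First c → X (ev c) ~ t → ¬ Shed ⊤ (enc t)
  ¬shed-neighbour (X a) c-first x~x =
    let (c′ , a≡od , c′-first) = first-block-neighbour c-first x~x
    in subst (λ a → ¬ Shed ⊤ (enc (X a))) (sym a≡od) (¬shed-odd-X c′-first)
  ¬shed-neighbour (Y b) c-first x~y = subst (λ b → ¬ Shed ⊤ (enc (Y b))) (X~Y⁻ x~y) (¬shed-even-Y c-first)
  ¬shed-neighbour (Z d) c-first (edge ())

  shed-not-dominating : ¬ Dominating ⊤ (Shed ⊤)
  shed-not-dominating dominating =
    let (c , c-first) = first 0 (≤-trans (s≤s z≤n) 2≤k)
        (u , u-shed , _ , x-u) = dominating (enc (X (ev c))) ∈⊤ (¬shed-even-X c-first)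
        (t , u≡t) = typed u
    in ¬shed-neighbour t c-first (Adj⇒~ (subst (Adj _) u≡t x-u)) (subst (Shed ⊤) u≡t u-shed)

corollary6p4 : (n : ℕ) (ks : List ℕ) → 1 ≤ length ks → All (2 ≤_) ks → sum ks ≡ n →
    GraphTheory.VertexDecomposable (Dadj n ks) ⊤
    × ¬ GraphTheory.Dominating (Dadj n ks) ⊤ (GraphTheory.Shed (Dadj n ks) ⊤)
corollary6p4 n [] () _ _
corollary6p4 n (k ∷ rest) _ (2≤k ∷ _) hn =
  Decomposition.vertexDecomposable n (k ∷ rest) hn , NonDomination.shed-not-dominating n k rest 2≤k hn
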